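{- Let $p\ge 3$ be a prime and let $r$ be an integer with $1\le r\le p-1$ such that $8r+1$ is a quadratic non-residue modulo $p$. Then for all integers $n\ge 0$ and all integers $k\ge j\ge 0$, \[ a_{p(k-j)+(p-1),\;pk+(p+1)}(pn+r)\equiv 0 \pmod p. \]
   Context: For positive integers $r,s$, $a_{r,s}(n)$ denotes the number of multicolored partitions of $n$ in which each even part may appear in one of $r$ colors and each odd part may appear in one of $s$ colors (copies of the same part size in different colors are distinct), with $a_{r,s}(0)=1$. Equivalently, for $|q|<1$, $\sum_{n\ge0}a_{r,s}(n)q^n = f_2^{s-r}/f_1^{s}$, where $f_m=\prod_{i\ge1}(1-q^{mi})$. -}

module Defs where

open import Data.Nat using (ℕ; zero; suc; _+_; _*_; _∸_; _≤ᵇ_; _%_)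
open import Data.Bool using (if_then_else_)
open import Data.Nat.ListAction using (sum)
open import Data.List using (List; []; _∷_; map; upTo; concatMap; replicate; applyUpTo)

-- Number of multisets drawn from a list of "kinds" (each kind is a part size;
-- repeated entries of the same size represent different colours) with total n.
-- For a kind of size k we choose its multiplicity t (0 ≤ t ≤ n suffices since k ≥ 1).
multisets : List ℕ → ℕ → ℕ
multisets []       zero    = 1
multisets []       (suc n) = 0
multisets (k ∷ ks) n =
  sum (map (λ t → if t * k ≤ᵇ n then multisets ks (n ∸ t * k) else 0) (upTo (suc n)))

colours : ℕ → ℕ → ℕ → ℕ
colours r s i = if (i % 2 ≤ᵇ 0) then r else s

kinds : ℕ → ℕ → ℕ → List ℕ
kinds r s n = concatMap (λ i → replicate (colours r s i) i) (applyUpTo suc n)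

a : ℕ → ℕ → ℕ → ℕ
a r s n = multisets (kinds r s n) n

open import Relation.Binary.PropositionalEquality using (_≡_)
open import Data.Product using (∃₂)
open import Relation.Nullary using (¬_)

CongMod : ℕ → ℕ → ℕ → Set
CongMod m x y = ∃₂ λ u v → x + u * m ≡ y + v * m

-- x is a quadratic non-residue modulo p: no square is congruent to x mod p
-- (in particular x is not ≡ 0 mod p)
QNR : ℕ → ℕ → Set
QNR p x = (y : ℕ) → ¬ CongMod p (y * y) x

-- Write G k = 1/(1 − X^k) in ℤ⟦X⟧.  The coefficient of X^N in ∏_{i ≤ N} G i ^ colours r s i is
-- a r s N, and modulo X^{N+1} the product may be extended to i ≤ 2N.  Work modulo the ideal
-- (p, X^{N+1}).  For r = p u + p − 1 and s = p k + p + 1 we have G i ^ s = (G i ^ p)^{k+1} · G i and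
-- G i ^ r = (G i ^ p)^{u+1} · (1 − X^i), while the Frobenius congruence (1 − X^i)^p ≡ 1 − X^{ip}
-- gives G i ^ p ≡ G (i p).  Pairing i = 2j+1 with i = 2j+2, the product becomes F · ∏_j
-- (1 − X^{2j+2})/(1 − X^{2j+1}) with F a power series in X^p.  By Gauss's identity, proved through
-- Shanks' finite form, the second factor is Σ_m X^{m(m+1)/2}, whose exponents j have 8j + 1 a
-- square.  A product X^{pt} · X^j contributing to X^{pn+r} would make 8r + 1 ≡ 8j + 1 a square
-- modulo p, so when 8r + 1 is a non-residue the coefficient of X^{pn+r} is divisible by p.

module Submission where

open import Algebra.Bundles using (CommutativeMonoid; CommutativeSemiring; CommutativeRing)
open import Algebra.Structures using (IsCommutativeRing)
import Algebra.Construct.Pointwise as Pointwise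
open import Data.Nat as ℕ using (ℕ; zero; suc; _!; z≤n; s≤s)
import Data.Nat.Properties as ℕₚ
open import Data.Nat.Divisibility
  using (_∣_; _∤_; _∣?_; _∣0; divides; >⇒∤; m∣m*n; n∣m*n; ∣-trans; ∣m∣n⇒∣m+n)
open import Data.Nat.DivMod using (m/n*n≡m; m≡m%n+[m/n]*n; m%n<n; [m+kn]%n≡m%n; m*n%n≡0)
open import Data.Nat.Primality using (Prime; euclidsLemma; prime⇒nonTrivial)
open import Data.Nat.Combinatorics using (_C_; nCn≡1; k![n∸k]!∣n!)
open import Data.Nat.Combinatorics.Specification using (nCk≡n!/k![n-k]!)
open import Data.Fin as Fin using (Fin; toℕ; fromℕ; inject₁)
import Data.Fin.Properties as Finₚ
open import Data.Integer as ℤ using (ℤ; 0ℤ; 1ℤ)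
import Data.Integer.Properties as ℤₚ
open import Data.Integer.Tactic.RingSolver using (solve-∀)
import Data.Nat.Tactic.RingSolver as ℕ-Solver
open import Data.Product using (∃; _,_; proj₁; proj₂)
open import Data.Sum using (inj₁; inj₂)
open import Function using (_∘_)
open import Level using (0ℓ)
open import Relation.Binary.PropositionalEquality as ≡
  using (_≡_; _≢_; _≗_; module ≡-Reasoning)
open import Relation.Binary.Bundles using (Preorder)
open import Relation.Binary.Structures using (IsPreorder)
import Relation.Binary.Reasoning.Setoid as SetoidReasoning
import Relation.Binary.Reasoning.Preorder as PreorderReasoning
open import Relation.Nullary using (¬_; yes; no; contradiction)
open import Relation.Unary using (Decidable)
open import Relation.Nullary.Reflects using (ofʸ)
open import Data.Bool using (true; false; if_then_else_)
open import Data.List using (List; []; _∷_; _++_; replicate; applyUpTo; concatMap)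
open import Data.List.Properties using (map-upTo)
open import Defs using (multisets; colours; a; QNR)

prime∤! : ∀ {p m} → Prime p → m ℕ.< p → p ∤ m !
prime∤! {p} {zero}  isPrime _   = >⇒∤ (ℕ.nonTrivial⇒n>1 p {{prime⇒nonTrivial isPrime}})
prime∤! {p} {suc m} isPrime m<p p∣m! with euclidsLemma (suc m) (m !) isPrime p∣m!
... | inj₁ p∣1+m = >⇒∤ m<p p∣1+m
... | inj₂ p∣m!  = prime∤! isPrime (ℕₚ.<-trans (ℕₚ.n<1+n m) m<p) p∣m!

nCk*k![n∸k]!≡n! : ∀ {n k} → k ℕ.≤ n → (n C k) ℕ.* (k ! ℕ.* (n ℕ.∸ k) !) ≡ n !
nCk*k![n∸k]!≡n! {n} {k} k≤n =
  ≡.trans (≡.cong (ℕ._* (k ! ℕ.* (n ℕ.∸ k) !)) (nCk≡n!/k![n-k]! k≤n))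
          (m/n*n≡m {{k ℕₚ.!* (n ℕ.∸ k) !≢0}} (k![n∸k]!∣n! k≤n))

prime∣pCk : ∀ {p k} → Prime p → 0 ℕ.< k → k ℕ.< p → p ∣ p C k
prime∣pCk {p@(suc p′)} {k} isPrime 0<k k<p
  with euclidsLemma (p C k) (k ! ℕ.* (p ℕ.∸ k) !) isPrime
         (≡.subst (p ∣_) (≡.sym (nCk*k![n∸k]!≡n! (ℕₚ.<⇒≤ k<p))) (m∣m*n (p′ !)))
... | inj₁ p∣pCk = p∣pCk
... | inj₂ p∣k![p∸k]! with euclidsLemma (k !) ((p ℕ.∸ k) !) isPrime p∣k![p∸k]!
...   | inj₁ p∣k!     = contradiction p∣k! (prime∤! isPrime k<p)
...   | inj₂ p∣[p∸k]! = contradiction p∣[p∸k]! (prime∤! isPrime (ℕₚ.∸-monoʳ-< 0<k (ℕₚ.<⇒≤ k<p)))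

-- j = y(y + 1)/2 for some y exactly when 8j + 1 = (2y + 1)².
Triangular : ℕ → Set
Triangular j = ∃ λ y → 8 ℕ.* j ℕ.+ 1 ≡ y ℕ.* y

qnr⇒disjoint : ∀ {p r} n → QNR p (8 ℕ.* r ℕ.+ 1) →
               ∀ i j → i ℕ.+ j ≡ p ℕ.* n ℕ.+ r → p ∣ i → ¬ Triangular j
qnr⇒disjoint {p} {r} n qnr i j i+j≡pn+r (divides t i≡t*p) (y , 8j+1≡y*y) =
  qnr y (8 ℕ.* t , 8 ℕ.* n , (begin
    y ℕ.* y ℕ.+ 8 ℕ.* t ℕ.* p         ≡⟨ ≡.cong (ℕ._+ 8 ℕ.* t ℕ.* p) 8j+1≡y*y ⟨
    8 ℕ.* j ℕ.+ 1 ℕ.+ 8 ℕ.* t ℕ.* p   ≡⟨ regroup j t p ⟩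
    8 ℕ.* (t ℕ.* p ℕ.+ j) ℕ.+ 1       ≡⟨ ≡.cong (λ x → 8 ℕ.* (x ℕ.+ j) ℕ.+ 1) i≡t*p ⟨
    8 ℕ.* (i ℕ.+ j) ℕ.+ 1             ≡⟨ ≡.cong (λ x → 8 ℕ.* x ℕ.+ 1) i+j≡pn+r ⟩
    8 ℕ.* (p ℕ.* n ℕ.+ r) ℕ.+ 1       ≡⟨ regroup′ p n r ⟩
    8 ℕ.* r ℕ.+ 1 ℕ.+ 8 ℕ.* n ℕ.* p   ∎))
  where
  open ≡-Reasoning
  regroup : ∀ j t p → 8 ℕ.* j ℕ.+ 1 ℕ.+ 8 ℕ.* t ℕ.* p ≡ 8 ℕ.* (t ℕ.* p ℕ.+ j) ℕ.+ 1
  regroup = ℕ-Solver.solve-∀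
  regroup′ : ∀ p n r → 8 ℕ.* (p ℕ.* n ℕ.+ r) ℕ.+ 1 ≡ 8 ℕ.* r ℕ.+ 1 ℕ.+ 8 ℕ.* n ℕ.* p
  regroup′ = ℕ-Solver.solve-∀

+m≡+n*c⇒n∣m : ∀ {m n} c → ℤ.+ m ≡ ℤ.+ n ℤ.* c → n ∣ m
+m≡+n*c⇒n∣m {m} {n} c m≡n*c =
  divides ℤ.∣ c ∣ (≡.trans (≡.cong ℤ.∣_∣ m≡n*c)
                   (≡.trans (ℤₚ.abs-* (ℤ.+ n) c) (ℕₚ.*-comm n ℤ.∣ c ∣)))

colours-odd : ∀ r s j → colours r s (suc (2 ℕ.* j)) ≡ s
colours-odd r s j = ≡.cong (λ x → if x ℕ.≤ᵇ 0 then r else s)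
  (≡.trans (≡.cong (λ x → suc x ℕ.% 2) (ℕₚ.*-comm 2 j)) ([m+kn]%n≡m%n 1 j 2))

colours-even : ∀ r s j → colours r s (suc (suc (2 ℕ.* j))) ≡ r
colours-even r s j = ≡.cong (λ x → if x ℕ.≤ᵇ 0 then r else s)
  (≡.trans (≡.cong (λ x → suc (suc x) ℕ.% 2) (ℕₚ.*-comm 2 j)) (m*n%n≡0 (suc j) 2))

module _ {c ℓ} (R : CommutativeSemiring c ℓ) where
  open CommutativeSemiring R
  open import Algebra.Properties.Semiring.Exp semiring using (_^_)
  open import Algebra.Properties.Monoid.Mult +-monoid using (_×_; ×-assocˡ)
  open import Algebra.Properties.CommutativeMonoid.Mult +-commutativeMonoid using (×-distrib-+)
  open import Algebra.Properties.Monoid.Sum +-monoid using (sum; sum-init-last; sum-replicate; sum-replicate-zero)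
  open import Algebra.Properties.CommutativeSemiring.Binomial R using (theorem; binomialTerm)
  open import Relation.Binary.Reasoning.Setoid setoid

  sum-of-multiples : ∀ {p n} (c : Fin n → ℕ) (z : Fin n → Carrier) → (∀ i → p ∣ c i) →
                     ∃ λ e → sum (λ i → c i × z i) ≈ p × e
  sum-of-multiples {p} {zero}  c z p∣c = 0# , trans (sym (sum-replicate-zero p)) (sum-replicate p)
  sum-of-multiples {p} {suc n} c z p∣c
    with p∣c Fin.zero | sum-of-multiples (c ∘ Fin.suc) (z ∘ Fin.suc) (p∣c ∘ Fin.suc)
  ... | divides d c₀≡d*p | e , sum≈p×e = d × z Fin.zero + e , (begin
    c Fin.zero × z Fin.zero + sum (λ i → c (Fin.suc i) × z (Fin.suc i))
      ≈⟨ +-cong (reflexive (≡.cong (_× z Fin.zero) (≡.trans c₀≡d*p (ℕₚ.*-comm d p)))) sum≈p×e ⟩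
    (p ℕ.* d) × z Fin.zero + p × e
      ≈⟨ +-congʳ (sym (×-assocˡ (z Fin.zero) p d)) ⟩
    p × (d × z Fin.zero) + p × e
      ≈⟨ sym (×-distrib-+ (d × z Fin.zero) e p) ⟩
    p × (d × z Fin.zero + e) ∎)

  freshmansDream : ∀ {p} → Prime p → ∀ x y → ∃ λ e → (x + y) ^ p ≈ x ^ p + y ^ p + p × e
  freshmansDream {p@(suc p′)} isPrime x y = e , (begin
    (x + y) ^ p
      ≈⟨ theorem p x y ⟩
    t Fin.zero + sum (t ∘ Fin.suc)
      ≈⟨ +-congˡ (sum-init-last (t ∘ Fin.suc)) ⟩
    t Fin.zero + (sum (t ∘ Fin.suc ∘ inject₁) + t (Fin.suc (fromℕ p′)))
      ≈⟨ +-cong first (+-cong middle last) ⟩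
    y ^ p + (p × e + x ^ p)
      ≈⟨ +-congˡ (+-comm (p × e) (x ^ p)) ⟩
    y ^ p + (x ^ p + p × e)
      ≈⟨ sym (+-assoc (y ^ p) (x ^ p) (p × e)) ⟩
    y ^ p + x ^ p + p × e
      ≈⟨ +-congʳ (+-comm (y ^ p) (x ^ p)) ⟩
    x ^ p + y ^ p + p × e ∎)
    where
    t : Fin (suc p) → Carrier
    t = binomialTerm x y p
    p∣middle : ∀ (i : Fin p′) → p ∣ p C suc (toℕ (inject₁ i))
    p∣middle i = prime∣pCk isPrime (s≤s z≤n)
      (s≤s (≡.subst (ℕ._< p′) (≡.sym (Finₚ.toℕ-inject₁ i)) (Finₚ.toℕ<n i)))
    multiple : ∃ λ e → sum (t ∘ Fin.suc ∘ inject₁) ≈ p × e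
    multiple = sum-of-multiples _ _ p∣middle
    e : Carrier
    e = proj₁ multiple
    middle : sum (t ∘ Fin.suc ∘ inject₁) ≈ p × e
    middle = proj₂ multiple
    first : t Fin.zero ≈ y ^ p
    first = trans (+-identityʳ _) (*-identityˡ (y ^ p))
    last : t (Fin.suc (fromℕ p′)) ≈ x ^ p
    last rewrite Finₚ.toℕ-fromℕ p′ | nCn≡1 p | ℕₚ.n∸n≡0 p′ =
      trans (+-identityʳ _) (*-identityʳ (x ^ p))

module BigOperator {c ℓ} (M : CommutativeMonoid c ℓ) where
  open CommutativeMonoid M
  open import Algebra.Properties.CommutativeSemigroup commutativeSemigroup using (interchange)
  open import Relation.Binary.Reasoning.Setoid setoid

  big : ℕ → (ℕ → Carrier) → Carrier
  big zero    f = ε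
  big (suc n) f = f 0 ∙ big n (f ∘ suc)

  cong< : ∀ n {f g} → (∀ i → i ℕ.< n → f i ≈ g i) → big n f ≈ big n g
  cong< zero    f≈g = refl
  cong< (suc n) f≈g = ∙-cong (f≈g 0 (s≤s z≤n)) (cong< n (λ i i<n → f≈g (suc i) (s≤s i<n)))

  cong : ∀ n {f g} → (∀ i → f i ≈ g i) → big n f ≈ big n g
  cong n f≈g = cong< n (λ i _ → f≈g i)

  neutral : ∀ n → big n (λ _ → ε) ≈ ε
  neutral zero    = refl
  neutral (suc n) = trans (identityˡ _) (neutral n)

  distrib : ∀ n f g → big n (λ i → f i ∙ g i) ≈ big n f ∙ big n g
  distrib zero    f g = sym (identityˡ ε)
  distrib (suc n) f g = begin
    (f 0 ∙ g 0) ∙ big n (λ i → f (suc i) ∙ g (suc i)) ≈⟨ ∙-congˡ (distrib n (f ∘ suc) (g ∘ suc)) ⟩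
    (f 0 ∙ g 0) ∙ (big n (f ∘ suc) ∙ big n (g ∘ suc)) ≈⟨ interchange _ _ _ _ ⟩
    (f 0 ∙ big n (f ∘ suc)) ∙ (g 0 ∙ big n (g ∘ suc)) ∎

  split : ∀ m n f → big (m ℕ.+ n) f ≈ big m f ∙ big n (λ i → f (m ℕ.+ i))
  split zero    n f = sym (identityˡ _)
  split (suc m) n f = trans (∙-congˡ (split m n (f ∘ suc))) (sym (assoc _ _ _))

  snoc : ∀ n f → big (suc n) f ≈ big n f ∙ f n
  snoc n f = begin
    big (suc n) f                ≡⟨ ≡.cong (λ k → big k f) (ℕₚ.+-comm 1 n) ⟩
    big (n ℕ.+ 1) f              ≈⟨ split n 1 f ⟩
    big n f ∙ (f (n ℕ.+ 0) ∙ ε)  ≈⟨ ∙-congˡ (identityʳ _) ⟩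
    big n f ∙ f (n ℕ.+ 0)        ≡⟨ ≡.cong (λ i → big n f ∙ f i) (ℕₚ.+-identityʳ n) ⟩
    big n f ∙ f n                ∎

  pairs : ∀ n f → big (2 ℕ.* n) f ≈ big n (λ j → f (2 ℕ.* j) ∙ f (suc (2 ℕ.* j)))
  pairs zero    f = refl
  pairs (suc n) f = begin
    big (2 ℕ.* suc n) f
      ≡⟨ ≡.cong (λ k → big k f) (ℕₚ.*-suc 2 n) ⟩
    f 0 ∙ (f 1 ∙ big (2 ℕ.* n) (f ∘ (2 ℕ.+_)))
      ≈⟨ trans (sym (assoc _ _ _)) (∙-congˡ (pairs n (f ∘ (2 ℕ.+_)))) ⟩
    (f 0 ∙ f 1) ∙ big n (λ j → f (2 ℕ.+ 2 ℕ.* j) ∙ f (3 ℕ.+ 2 ℕ.* j))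
      ≈⟨ ∙-congˡ (cong n (λ j → reflexive (≡.cong (λ i → f i ∙ f (suc i)) (≡.sym (ℕₚ.*-suc 2 j))))) ⟩
    (f 0 ∙ f 1) ∙ big n (λ j → f (2 ℕ.* suc j) ∙ f (suc (2 ℕ.* suc j))) ∎

module MultisetCount where
  open import Data.Nat.ListAction using (sum)
  open ≡-Reasoning

  multiplicityTerm : ℕ → List ℕ → ℕ → ℕ → ℕ
  multiplicityTerm k L n t = if t ℕ.* k ℕ.≤ᵇ n then multisets L (n ℕ.∸ t ℕ.* k) else 0

  multisets-∷ : ∀ k L n → multisets (k ∷ L) n ≡ sum (applyUpTo (multiplicityTerm k L n) (suc n))
  multisets-∷ k L n = ≡.cong sum (map-upTo (multiplicityTerm k L n) (suc n))

  sum-applyUpTo-cong : ∀ {g h : ℕ → ℕ} → g ≗ h → ∀ b → sum (applyUpTo g b) ≡ sum (applyUpTo h b)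
  sum-applyUpTo-cong g≗h zero    = ≡.refl
  sum-applyUpTo-cong g≗h (suc b) = ≡.cong₂ ℕ._+_ (g≗h 0) (sum-applyUpTo-cong (g≗h ∘ suc) b)

  sum-applyUpTo-truncate : ∀ (g : ℕ → ℕ) b → (∀ t → b ℕ.≤ t → g t ≡ 0) →
                           ∀ a → b ℕ.≤ a → sum (applyUpTo g a) ≡ sum (applyUpTo g b)
  sum-applyUpTo-truncate g zero    g≡0 zero    _         = ≡.refl
  sum-applyUpTo-truncate g zero    g≡0 (suc a) _         =
    ≡.cong₂ ℕ._+_ (g≡0 0 z≤n) (sum-applyUpTo-truncate (g ∘ suc) zero (λ t _ → g≡0 (suc t) z≤n) a z≤n)
  sum-applyUpTo-truncate g (suc b) g≡0 (suc a) (s≤s b≤a) =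
    ≡.cong (g 0 ℕ.+_) (sum-applyUpTo-truncate (g ∘ suc) b (λ t b≤t → g≡0 (suc t) (s≤s b≤t)) a b≤a)

  ≤ᵇ-cancelˡ-+ : ∀ k x y → (k ℕ.+ x ℕ.≤ᵇ k ℕ.+ y) ≡ (x ℕ.≤ᵇ y)
  ≤ᵇ-cancelˡ-+ zero    x y = ≡.refl
  ≤ᵇ-cancelˡ-+ (suc k) x y = ≡.trans (suc≤ᵇsuc (k ℕ.+ x) (k ℕ.+ y)) (≤ᵇ-cancelˡ-+ k x y)
    where
    suc≤ᵇsuc : ∀ x y → (suc x ℕ.≤ᵇ suc y) ≡ (x ℕ.≤ᵇ y)
    suc≤ᵇsuc zero    y = ≡.refl
    suc≤ᵇsuc (suc x) y = ≡.refl

  multiplicityTerm-> : ∀ k L n t → n ℕ.< t ℕ.* k → multiplicityTerm k L n t ≡ 0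
  multiplicityTerm-> k L n t n<tk with t ℕ.* k ℕ.≤ᵇ n | ℕₚ.≤ᵇ-reflects-≤ (t ℕ.* k) n
  ... | false | _         = ≡.refl
  ... | true  | ofʸ tk≤n = contradiction tk≤n (ℕₚ.<⇒≱ n<tk)

  multiplicityTerm-shift : ∀ k L m t →
    multiplicityTerm (suc k) L (suc k ℕ.+ m) (suc t) ≡ multiplicityTerm (suc k) L m t
  multiplicityTerm-shift k L m t
    rewrite ≤ᵇ-cancelˡ-+ (suc k) (t ℕ.* suc k) m | ℕₚ.[m+n]∸[m+o]≡n∸o (suc k) m (t ℕ.* suc k) = ≡.refl

  multisets-∷-< : ∀ k L n → n ℕ.< k → multisets (k ∷ L) n ≡ multisets L n
  multisets-∷-< k L n n<k = begin
    multisets (k ∷ L) n                                                  ≡⟨ multisets-∷ k L n ⟩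
    multisets L n ℕ.+ sum (applyUpTo (multiplicityTerm k L n ∘ suc) n)  ≡⟨ ≡.cong (multisets L n ℕ.+_) no-copies ⟩
    multisets L n ℕ.+ 0                                                  ≡⟨ ℕₚ.+-identityʳ _ ⟩
    multisets L n                                                        ∎
    where
    no-copies : sum (applyUpTo (multiplicityTerm k L n ∘ suc) n) ≡ 0
    no-copies = sum-applyUpTo-truncate _ 0 (λ t _ → multiplicityTerm-> k L n (suc t)
                  (ℕₚ.<-≤-trans n<k (ℕₚ.m≤m+n k (t ℕ.* k)))) n z≤n

  multisets-∷-+ : ∀ k L m → multisets (suc k ∷ L) (suc k ℕ.+ m) ≡
                             multisets L (suc k ℕ.+ m) ℕ.+ multisets (suc k ∷ L) m
  multisets-∷-+ k L m = begin
    multisets (K ∷ L) (K ℕ.+ m)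
      ≡⟨ multisets-∷ K L (K ℕ.+ m) ⟩
    multisets L (K ℕ.+ m) ℕ.+ sum (applyUpTo (multiplicityTerm K L (K ℕ.+ m) ∘ suc) (K ℕ.+ m))
      ≡⟨ ≡.cong (multisets L (K ℕ.+ m) ℕ.+_) at-least-one-copy ⟩
    multisets L (K ℕ.+ m) ℕ.+ multisets (K ∷ L) m ∎
    where
    K : ℕ
    K = suc k
    beyond : ∀ t → suc m ℕ.≤ t → multiplicityTerm K L m t ≡ 0
    beyond t m<t = multiplicityTerm-> K L m t (ℕₚ.<-≤-trans m<t (ℕₚ.m≤m*n t K))
    at-least-one-copy : sum (applyUpTo (multiplicityTerm K L (K ℕ.+ m) ∘ suc) (K ℕ.+ m)) ≡ multisets (K ∷ L) m
    at-least-one-copy = begin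
      sum (applyUpTo (multiplicityTerm K L (K ℕ.+ m) ∘ suc) (K ℕ.+ m))
        ≡⟨ sum-applyUpTo-cong (multiplicityTerm-shift k L m) (K ℕ.+ m) ⟩
      sum (applyUpTo (multiplicityTerm K L m) (K ℕ.+ m))
        ≡⟨ sum-applyUpTo-truncate _ (suc m) beyond (K ℕ.+ m) (s≤s (ℕₚ.m≤n+m m k)) ⟩
      sum (applyUpTo (multiplicityTerm K L m) (suc m))
        ≡⟨ multisets-∷ K L m ⟨
      multisets (K ∷ L) m ∎

open MultisetCount using (multisets-∷-<; multisets-∷-+)

module PowerSeries where

  open import Data.Integer using (_+_; _*_; -_)

  Series : Set
  Series = ℕ → ℤ

  const : ℤ → Series
  const c zero    = c
  const c (suc _) = 0ℤ

  0ₛ 1ₛ : Series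
  0ₛ = λ _ → 0ℤ
  1ₛ = const 1ℤ

  tail : Series → Series
  tail f n = f (suc n)

  infixl 6 _⊕_
  infixl 7 _⊛_

  _⊕_ : Series → Series → Series
  (f ⊕ g) n = f n + g n

  ⊝_ : Series → Series
  (⊝ f) n = - f n

  -- Cauchy product, via f = f 0 + X · tail f.
  _⊛_ : Series → Series → Series
  (f ⊛ g) zero    = f 0 * g 0
  (f ⊛ g) (suc n) = f 0 * g (suc n) + (tail f ⊛ g) n

  ⊛-cong : ∀ {f f′ g g′} → f ≗ f′ → g ≗ g′ → f ⊛ g ≗ f′ ⊛ g′
  ⊛-cong f≗f′ g≗g′ zero    = ≡.cong₂ _*_ (f≗f′ 0) (g≗g′ 0)
  ⊛-cong f≗f′ g≗g′ (suc n) =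
    ≡.cong₂ _+_ (≡.cong₂ _*_ (f≗f′ 0) (g≗g′ (suc n))) (⊛-cong (f≗f′ ∘ suc) g≗g′ n)

  ⊛-zeroˡ : ∀ g → 0ₛ ⊛ g ≗ 0ₛ
  ⊛-zeroˡ g zero    = ℤₚ.*-zeroˡ (g 0)
  ⊛-zeroˡ g (suc n) = ≡.cong₂ _+_ (ℤₚ.*-zeroˡ (g (suc n))) (⊛-zeroˡ g n)

  const-⊛ : ∀ c g → const c ⊛ g ≗ λ n → c * g n
  const-⊛ c g zero    = ≡.refl
  const-⊛ c g (suc n) =
    ≡.trans (≡.cong ((c * g (suc n)) +_) (⊛-zeroˡ g n)) (ℤₚ.+-identityʳ _)

  ⊛-identityˡ : ∀ f → 1ₛ ⊛ f ≗ f
  ⊛-identityˡ f n = ≡.trans (const-⊛ 1ℤ f n) (ℤₚ.*-identityˡ (f n))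

  ⊛-distribʳ : ∀ h f g → (f ⊕ g) ⊛ h ≗ f ⊛ h ⊕ g ⊛ h
  ⊛-distribʳ h f g zero    = ℤₚ.*-distribʳ-+ (h 0) (f 0) (g 0)
  ⊛-distribʳ h f g (suc n) =
    ≡.trans (≡.cong (((f 0 + g 0) * h (suc n)) +_) (⊛-distribʳ h (tail f) (tail g) n))
            (shuffle (f 0) (g 0) (h (suc n)) _ _)
    where
    shuffle : ∀ a b c d e → (a + b) * c + (d + e) ≡ (a * c + d) + (b * c + e)
    shuffle = solve-∀

  ⊛-distribˡ : ∀ h f g → h ⊛ (f ⊕ g) ≗ h ⊛ f ⊕ h ⊛ g
  ⊛-distribˡ h f g zero    = ℤₚ.*-distribˡ-+ (h 0) (f 0) (g 0)
  ⊛-distribˡ h f g (suc n) =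
    ≡.trans (≡.cong ((h 0 * (f (suc n) + g (suc n))) +_) (⊛-distribˡ (tail h) f g n))
            (shuffle (h 0) (f (suc n)) (g (suc n)) _ _)
    where
    shuffle : ∀ a b c d e → a * (b + c) + (d + e) ≡ (a * b + d) + (a * c + e)
    shuffle = solve-∀

  ⊛-unfoldʳ : ∀ f g n → (f ⊛ g) (suc n) ≡ f (suc n) * g 0 + (f ⊛ tail g) n
  ⊛-unfoldʳ f g zero    = ℤₚ.+-comm (f 0 * g 1) (f 1 * g 0)
  ⊛-unfoldʳ f g (suc n) =
    ≡.trans (≡.cong ((f 0 * g (suc (suc n))) +_) (⊛-unfoldʳ (tail f) g n))
            (swap (f 0 * g (suc (suc n))) (f (suc (suc n)) * g 0) ((tail f ⊛ tail g) n))
    where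
    swap : ∀ a b c → a + (b + c) ≡ b + (a + c)
    swap = solve-∀

  ⊛-comm : ∀ f g → f ⊛ g ≗ g ⊛ f
  ⊛-comm f g zero    = ℤₚ.*-comm (f 0) (g 0)
  ⊛-comm f g (suc n) =
    ≡.trans (≡.cong₂ _+_ (ℤₚ.*-comm (f 0) (g (suc n))) (⊛-comm (tail f) g n))
            (≡.sym (⊛-unfoldʳ g f n))

  tail-⊛ : ∀ f g → tail (f ⊛ g) ≗ const (f 0) ⊛ tail g ⊕ tail f ⊛ g
  tail-⊛ f g n = ≡.cong (_+ (tail f ⊛ g) n) (≡.sym (const-⊛ (f 0) (tail g) n))

  ⊛-assoc : ∀ f g h → (f ⊛ g) ⊛ h ≗ f ⊛ (g ⊛ h)
  ⊛-assoc f g h zero    = ℤₚ.*-assoc (f 0) (g 0) (h 0)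
  ⊛-assoc f g h (suc n) = begin
    (f 0 * g 0) * h (suc n) + (tail (f ⊛ g) ⊛ h) n
      ≡⟨ ≡.cong ((f 0 * g 0 * h (suc n)) +_) (⊛-cong (tail-⊛ f g) (λ _ → ≡.refl) n) ⟩
    (f 0 * g 0) * h (suc n) + ((const (f 0) ⊛ tail g ⊕ tail f ⊛ g) ⊛ h) n
      ≡⟨ ≡.cong ((f 0 * g 0 * h (suc n)) +_) (⊛-distribʳ h (const (f 0) ⊛ tail g) (tail f ⊛ g) n) ⟩
    (f 0 * g 0) * h (suc n) + (((const (f 0) ⊛ tail g) ⊛ h) n + ((tail f ⊛ g) ⊛ h) n)
      ≡⟨ ≡.cong₂ (λ u v → f 0 * g 0 * h (suc n) + (u + v))
               (≡.trans (⊛-assoc (const (f 0)) (tail g) h n) (const-⊛ (f 0) (tail g ⊛ h) n))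
               (⊛-assoc (tail f) g h n) ⟩
    (f 0 * g 0) * h (suc n) + (f 0 * (tail g ⊛ h) n + (tail f ⊛ (g ⊛ h)) n)
      ≡⟨ regroup (f 0) (g 0) (h (suc n)) _ _ ⟩
    f 0 * (g 0 * h (suc n) + (tail g ⊛ h) n) + (tail f ⊛ (g ⊛ h)) n ∎
    where
    open ≡-Reasoning
    regroup : ∀ a b c d e → (a * b) * c + (a * d + e) ≡ a * (b * c + d) + e
    regroup = solve-∀

  isCommutativeRing : IsCommutativeRing _≗_ _⊕_ _⊛_ ⊝_ 0ₛ 1ₛ
  isCommutativeRing = record
    { isRing = record
      { +-isAbelianGroup = Pointwise.isAbelianGroup ℕ ℤₚ.+-0-isAbelianGroup
      ; *-cong           = ⊛-cong
      ; *-assoc          = ⊛-assoc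
      ; *-identity       = ⊛-identityˡ , λ f n → ≡.trans (⊛-comm f 1ₛ n) (⊛-identityˡ f n)
      ; distrib          = ⊛-distribˡ , ⊛-distribʳ
      }
    ; *-comm = ⊛-comm
    }

  ring : CommutativeRing 0ℓ 0ℓ
  ring = record { isCommutativeRing = isCommutativeRing }

module GeneratingFunctions where

  open PowerSeries using (Series; const; tail; 1ₛ; ⊛-cong; const-⊛)
  open CommutativeRing PowerSeries.ring hiding (zero)
  open import Algebra.Properties.Semiring.Exp semiring using (_^_; ^-homo-*; ^-assocʳ; ^-congˡ; ^-congʳ)
  open import Algebra.Properties.CommutativeSemiring.Exp commutativeSemiring using (^-distrib-*)
  open import Algebra.Properties.Monoid.Mult +-monoid using (_×_; ×-congʳ)
  open import Algebra.Properties.Semiring.Mult semiring using (×-assoc-*)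
  open import Algebra.Properties.CommutativeSemigroup *-commutativeSemigroup
    using (x∙yz≈xz∙y; x∙yz≈y∙zx; xy∙z≈y∙xz)
  module ≈-Reasoning = SetoidReasoning setoid

  module SeriesSolver where
    open import Algebra.Solver.Ring.AlmostCommutativeRing
      using (_-Raw-AlmostCommutative⟶_; fromCommutativeRing)
    open import Data.Maybe using (Maybe; just; nothing)

    const-homomorphism : ℤ.+-*-rawRing -Raw-AlmostCommutative⟶ fromCommutativeRing PowerSeries.ring
    const-homomorphism = record
      { ⟦_⟧    = const
      ; +-homo = λ { a b zero → ≡.refl ; a b (suc n) → ≡.refl }
      ; *-homo = λ { a b zero → ≡.refl
                   ; a b (suc n) → ≡.sym (≡.trans (const-⊛ a (const b) (suc n)) (ℤₚ.*-zeroʳ a)) }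
      ; -‿homo = λ { a zero → ≡.refl ; a (suc n) → ≡.refl }
      ; 0-homo = λ { zero → ≡.refl ; (suc n) → ≡.refl }
      ; 1-homo = λ _ → ≡.refl
      }

    const-≟ : ∀ a b → Maybe (const a ≈ const b)
    const-≟ a b with a ℤ.≟ b
    ... | yes ≡.refl = just refl
    ... | no _       = nothing

    open import Algebra.Solver.Ring ℤ.+-*-rawRing (fromCommutativeRing PowerSeries.ring)
      const-homomorphism const-≟ public

  open SeriesSolver using (solve; _:=_; _:+_; _:-_; _:*_; :-_; con)

  X : Series
  X 1 = 1ℤ
  X _ = 0ℤ

  X*-coeff-suc : ∀ f n → (X * f) (suc n) ≡ f n
  X*-coeff-suc f n =
    ≡.trans (ℤₚ.+-identityˡ _) (≡.trans (⊛-cong tail-X (λ _ → ≡.refl) n) (*-identityˡ f n))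
    where
    tail-X : tail X ≗ 1ₛ
    tail-X zero    = ≡.refl
    tail-X (suc _) = ≡.refl

  X^*-coeff-< : ∀ k f {n} → n ℕ.< k → (X ^ k * f) n ≡ 0ℤ
  X^*-coeff-< (suc k) f {zero}  _         = ≡.refl
  X^*-coeff-< (suc k) f {suc n} (s≤s n<k) =
    ≡.trans (*-assoc X (X ^ k) f (suc n)) (≡.trans (X*-coeff-suc (X ^ k * f) n) (X^*-coeff-< k f n<k))

  X^*-coeff-+ : ∀ k f m → (X ^ k * f) (k ℕ.+ m) ≡ f m
  X^*-coeff-+ zero    f m = *-identityˡ f m
  X^*-coeff-+ (suc k) f m =
    ≡.trans (*-assoc X (X ^ k) f (suc k ℕ.+ m)) (≡.trans (X*-coeff-suc (X ^ k * f) (k ℕ.+ m)) (X^*-coeff-+ k f m))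

  X^-coeff-≢ : ∀ k {n} → n ≢ k → (X ^ k) n ≡ 0ℤ
  X^-coeff-≢ k {n} n≢k with ℕₚ.<-≤-connex n k
  ... | inj₁ n<k = ≡.trans (≡.sym (*-identityʳ (X ^ k) n)) (X^*-coeff-< k 1ₛ n<k)
  ... | inj₂ k≤n with ℕₚ.m≤n⇒∃[o]m+o≡n k≤n
  ...   | zero  , k+0≡n = contradiction (≡.trans (≡.sym k+0≡n) (ℕₚ.+-identityʳ k)) n≢k
  ...   | suc m , ≡.refl = ≡.trans (≡.sym (*-identityʳ (X ^ k) n)) (X^*-coeff-+ k 1ₛ (suc m))

  module ∑ = BigOperator +-commutativeMonoid
  module ∏ = BigOperator *-commutativeMonoid

  ∑< ∏< : ℕ → (ℕ → Series) → Series
  ∑< = ∑.big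
  ∏< = ∏.big

  infix 5 ∑< ∏<
  syntax ∑< n (λ i → e) = ∑[ i < n ] e
  syntax ∏< n (λ i → e) = ∏[ i < n ] e

  ∑-*-distribʳ : ∀ n f c → ∑< n f * c ≈ ∑[ j < n ] (f j * c)
  ∑-*-distribʳ zero    f c = zeroˡ c
  ∑-*-distribʳ (suc n) f c =
    trans (distribʳ c (f 0) (∑< n (f ∘ suc))) (+-congˡ {f 0 * c} (∑-*-distribʳ n (f ∘ suc) c))

  ∑-*-distribˡ : ∀ n c f → c * ∑< n f ≈ ∑[ j < n ] (c * f j)
  ∑-*-distribˡ n c f =
    trans (*-comm c (∑< n f)) (trans (∑-*-distribʳ n f c) (∑.cong n (λ j → *-comm (f j) c)))

  ∑-telescope : ∀ n (u w : ℕ → Series) → (∀ j → j ℕ.< n → u j ≈ w (suc j)) →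
                ∑[ j < suc n ] (u j - w j) ≈ u n - w 0
  ∑-telescope zero    u w _       = +-identityʳ (u 0 - w 0)
  ∑-telescope (suc n) u w u≈w∘suc = begin
    (u 0 - w 0) + (∑[ j < suc n ] (u (suc j) - w (suc j)))
      ≈⟨ +-congˡ {u 0 - w 0} (∑-telescope n (u ∘ suc) (w ∘ suc) (λ j j<n → u≈w∘suc (suc j) (s≤s j<n))) ⟩
    (u 0 - w 0) + (u (suc n) - w 1)
      ≈⟨ +-congˡ {u 0 - w 0} (+-congˡ {u (suc n)} (-‿cong (u≈w∘suc 0 (s≤s z≤n)))) ⟨
    (u 0 - w 0) + (u (suc n) - u 0)
      ≈⟨ solve 3 (λ a b c → (a :- b) :+ (c :- a) := c :- b) refl (u 0) (w 0) (u (suc n)) ⟩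
    u (suc n) - w 0 ∎
    where open ≈-Reasoning

  1#^n≈1# : ∀ n → 1# ^ n ≈ 1#
  1#^n≈1# zero    = refl
  1#^n≈1# (suc n) = trans (*-identityˡ (1# ^ n)) (1#^n≈1# n)

  x^[n+1]≈x^n*x : ∀ x n → x ^ (n ℕ.+ 1) ≈ x ^ n * x
  x^[n+1]≈x^n*x x n = trans (^-homo-* x n 1) (*-congˡ {x ^ n} (*-identityʳ x))

  ×-coeff : ∀ n f i → (n × f) i ≡ ℤ.+ n ℤ.* f i
  ×-coeff zero    f i = ≡.sym (ℤₚ.*-zeroˡ (f i))
  ×-coeff (suc n) f i = ≡.trans (≡.cong (ℤ._+_ (f i)) (×-coeff n f i)) (≡.sym (ℤₚ.suc-* (ℤ.+ n) (f i)))

  x+y*0≈x : ∀ x y → x + y * 0# ≈ x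
  x+y*0≈x x y = trans (+-congˡ {x} (zeroʳ y)) (+-identityʳ x)

  multisetSeries : List ℕ → Series
  multisetSeries L n = ℤ.+ multisets L n

  multisetSeries-[] : multisetSeries [] ≈ 1#
  multisetSeries-[] zero    = ≡.refl
  multisetSeries-[] (suc n) = ≡.refl

  multisetSeries-∷ : ∀ k L →
    multisetSeries (suc k ∷ L) ≈ multisetSeries L + X ^ suc k * multisetSeries (suc k ∷ L)
  multisetSeries-∷ k L n with ℕₚ.<-≤-connex n (suc k)
  ... | inj₁ n<1+k = ≡.sym (begin
    multisetSeries L n ℤ.+ (X ^ suc k * multisetSeries (suc k ∷ L)) n
      ≡⟨ ≡.cong (ℤ._+_ (multisetSeries L n)) (X^*-coeff-< (suc k) (multisetSeries (suc k ∷ L)) n<1+k) ⟩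
    multisetSeries L n ℤ.+ 0ℤ
      ≡⟨ ℤₚ.+-identityʳ _ ⟩
    multisetSeries L n
      ≡⟨ ≡.cong ℤ.+_ (multisets-∷-< (suc k) L n n<1+k) ⟨
    multisetSeries (suc k ∷ L) n ∎)
    where open ≡-Reasoning
  ... | inj₂ 1+k≤n with ℕₚ.m≤n⇒∃[o]m+o≡n 1+k≤n
  ...   | m , ≡.refl = begin
    multisetSeries (suc k ∷ L) (suc k ℕ.+ m)
      ≡⟨ ≡.cong ℤ.+_ (multisets-∷-+ k L m) ⟩
    ℤ.+ (multisets L (suc k ℕ.+ m) ℕ.+ multisets (suc k ∷ L) m)
      ≡⟨ ℤₚ.pos-+ (multisets L (suc k ℕ.+ m)) (multisets (suc k ∷ L) m) ⟩
    multisetSeries L (suc k ℕ.+ m) ℤ.+ multisetSeries (suc k ∷ L) m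
      ≡⟨ ≡.cong (ℤ._+_ (multisetSeries L (suc k ℕ.+ m))) (X^*-coeff-+ (suc k) (multisetSeries (suc k ∷ L)) m) ⟨
    multisetSeries L (suc k ℕ.+ m) ℤ.+ (X ^ suc k * multisetSeries (suc k ∷ L)) (suc k ℕ.+ m) ∎
    where open ≡-Reasoning

  x≈y+z*x⇒[1-z]*x≈y : ∀ {x y z} → x ≈ y + z * x → (1# - z) * x ≈ y
  x≈y+z*x⇒[1-z]*x≈y {x} {y} {z} x≈y+zx = begin
    (1# - z) * x        ≈⟨ solve 2 (λ x z → (con 1ℤ :- z) :* x := x :- z :* x) refl x z ⟩
    x - z * x           ≈⟨ +-congʳ x≈y+zx ⟩
    (y + z * x) - z * x ≈⟨ solve 2 (λ y w → (y :+ w) :- w := y) refl y (z * x) ⟩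
    y                   ∎
    where open ≈-Reasoning

  geometric : ℕ → Series
  geometric k = multisetSeries (k ∷ [])

  geometric-inverse : ∀ k → (1# - X ^ suc k) * geometric (suc k) ≈ 1#
  geometric-inverse k = x≈y+z*x⇒[1-z]*x≈y (trans (multisetSeries-∷ k []) (+-congʳ multisetSeries-[]))

  [1-X^]*u≈v⇒u≈geometric*v : ∀ k {u v} → (1# - X ^ suc k) * u ≈ v → u ≈ geometric (suc k) * v
  [1-X^]*u≈v⇒u≈geometric*v k {u} {v} [1-y]u≈v = begin
    u                      ≈⟨ *-identityˡ u ⟨
    1# * u                 ≈⟨ *-congʳ (geometric-inverse k) ⟨
    ((1# - y) * g) * u     ≈⟨ xy∙z≈y∙xz (1# - y) g u ⟩
    g * ((1# - y) * u)     ≈⟨ *-congˡ [1-y]u≈v ⟩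
    g * v                  ∎
    where
    open ≈-Reasoning
    y g : Series
    y = X ^ suc k
    g = geometric (suc k)

  [1-X^]-cancelʳ : ∀ k {u v} → u * (1# - X ^ suc k) ≈ v * (1# - X ^ suc k) → u ≈ v
  [1-X^]-cancelʳ k {u} {v} u[1-y]≈v[1-y] = begin
    u                     ≈⟨ [1-X^]*u≈v⇒u≈geometric*v k (trans (*-comm (1# - y) u) u[1-y]≈v[1-y]) ⟩
    g * (v * (1# - y))    ≈⟨ x∙yz≈y∙zx g v (1# - y) ⟩
    v * ((1# - y) * g)    ≈⟨ *-congˡ {v} (geometric-inverse k) ⟩
    v * 1#                ≈⟨ *-identityʳ v ⟩
    v                     ∎
    where
    open ≈-Reasoning
    y g : Series
    y = X ^ suc k
    g = geometric (suc k)

  multisetSeries-∷-* : ∀ k L → multisetSeries (suc k ∷ L) ≈ geometric (suc k) * multisetSeries L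
  multisetSeries-∷-* k L = [1-X^]*u≈v⇒u≈geometric*v k (x≈y+z*x⇒[1-z]*x≈y (multisetSeries-∷ k L))

  multisetSeries-replicate-++ : ∀ c k L →
    multisetSeries (replicate c (suc k) ++ L) ≈ geometric (suc k) ^ c * multisetSeries L
  multisetSeries-replicate-++ zero    k L = sym (*-identityˡ _)
  multisetSeries-replicate-++ (suc c) k L = begin
    multisetSeries (suc k ∷ replicate c (suc k) ++ L)    ≈⟨ multisetSeries-∷-* k (replicate c (suc k) ++ L) ⟩
    g * multisetSeries (replicate c (suc k) ++ L)        ≈⟨ *-congˡ (multisetSeries-replicate-++ c k L) ⟩
    g * (g ^ c * multisetSeries L)                       ≈⟨ *-assoc g (g ^ c) (multisetSeries L) ⟨
    g * g ^ c * multisetSeries L                         ∎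
    where
    open ≈-Reasoning
    g : Series
    g = geometric (suc k)

  multisetSeries-coloured : ∀ (c g : ℕ → ℕ) n →
    multisetSeries (concatMap (λ i → replicate (c i) i) (applyUpTo (suc ∘ g) n)) ≈
    ∏[ i < n ] geometric (suc (g i)) ^ c (suc (g i))
  multisetSeries-coloured c g zero    = multisetSeries-[]
  multisetSeries-coloured c g (suc n) =
    trans (multisetSeries-replicate-++ (c (suc (g 0))) (g 0) _)
          (*-congˡ (multisetSeries-coloured c (g ∘ suc) n))

  a≡∏-coeff : ∀ r s N → ℤ.+ a r s N ≡ (∏[ i < N ] geometric (suc i) ^ colours r s (suc i)) N
  a≡∏-coeff r s N = multisetSeries-coloured (colours r s) (λ i → i) N N

  -- Congruences modulo (p, X^{N+1})

  module IdealCongruence (P Q : Series) where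

    infix 4 _∼_
    record _∼_ (f g : Series) : Set where
      constructor differ-by
      field
        cofactor₁ cofactor₂ : Series
        equation            : f ≈ g + (P * cofactor₁ + Q * cofactor₂)

    ≈+P*⇒∼ : ∀ {f g} c → f ≈ g + P * c → f ∼ g
    ≈+P*⇒∼ {f} {g} c f≈g+Pc = differ-by c 0# (trans f≈g+Pc (+-congˡ {g} (sym (x+y*0≈x (P * c) Q))))

    ≈+Q*⇒∼ : ∀ {f g} d → f ≈ g + Q * d → f ∼ g
    ≈+Q*⇒∼ {f} {g} d f≈g+Qd = differ-by 0# d
      (trans f≈g+Qd (+-congˡ {g} (sym (trans (+-comm (P * 0#) (Q * d)) (x+y*0≈x (Q * d) P)))))

    ≈⇒∼ : ∀ {f g} → f ≈ g → f ∼ g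
    ≈⇒∼ {f} {g} f≈g = ≈+Q*⇒∼ 0# (trans f≈g (sym (x+y*0≈x g Q)))

    ∼-sym : ∀ {f g} → f ∼ g → g ∼ f
    ∼-sym {f} {g} (differ-by c d f≈g+r) = differ-by (- c) (- d) (begin
      g
        ≈⟨ solve 2 (λ g r → g := (g :+ r) :- r) refl g (P * c + Q * d) ⟩
      (g + (P * c + Q * d)) - (P * c + Q * d)
        ≈⟨ +-congʳ f≈g+r ⟨
      f - (P * c + Q * d)
        ≈⟨ solve 5 (λ f P Q c d → f :- (P :* c :+ Q :* d) := f :+ (P :* (:- c) :+ Q :* (:- d)))
                 refl f P Q c d ⟩
      f + (P * - c + Q * - d) ∎)
      where open ≈-Reasoning

    ∼-trans : ∀ {f g h} → f ∼ g → g ∼ h → f ∼ h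
    ∼-trans {f} {g} {h} (differ-by c d f≈g+r) (differ-by c′ d′ g≈h+r′) =
      differ-by (c + c′) (d + d′) (begin
      f
        ≈⟨ f≈g+r ⟩
      g + (P * c + Q * d)
        ≈⟨ +-congʳ g≈h+r′ ⟩
      (h + (P * c′ + Q * d′)) + (P * c + Q * d)
        ≈⟨ solve 7 (λ h P Q c d c′ d′ →
                      (h :+ (P :* c′ :+ Q :* d′)) :+ (P :* c :+ Q :* d)
                   := h :+ (P :* (c :+ c′) :+ Q :* (d :+ d′)))
                 refl h P Q c d c′ d′ ⟩
      h + (P * (c + c′) + Q * (d + d′)) ∎)
      where open ≈-Reasoning

    ∼-+ : ∀ {f g f′ g′} → f ∼ g → f′ ∼ g′ → f + f′ ∼ g + g′
    ∼-+ {f} {g} {f′} {g′} (differ-by c d f≈g+r) (differ-by c′ d′ f′≈g′+r′) =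
      differ-by (c + c′) (d + d′) (begin
      f + f′
        ≈⟨ +-cong f≈g+r f′≈g′+r′ ⟩
      (g + (P * c + Q * d)) + (g′ + (P * c′ + Q * d′))
        ≈⟨ solve 8 (λ g g′ P Q c d c′ d′ →
                      (g :+ (P :* c :+ Q :* d)) :+ (g′ :+ (P :* c′ :+ Q :* d′))
                   := (g :+ g′) :+ (P :* (c :+ c′) :+ Q :* (d :+ d′)))
                 refl g g′ P Q c d c′ d′ ⟩
      (g + g′) + (P * (c + c′) + Q * (d + d′)) ∎)
      where open ≈-Reasoning

    ∼-* : ∀ {f g f′ g′} → f ∼ g → f′ ∼ g′ → f * f′ ∼ g * g′
    ∼-* {f} {g} {f′} {g′} (differ-by c d f≈g+r) (differ-by c′ d′ f′≈g′+r′) =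
      differ-by (c * f′ + g * c′) (d * f′ + g * d′) (begin
      f * f′
        ≈⟨ *-congʳ {f′} f≈g+r ⟩
      (g + (P * c + Q * d)) * f′
        ≈⟨ solve 6 (λ g f′ P Q c d →
                      (g :+ (P :* c :+ Q :* d)) :* f′
                   := g :* f′ :+ (P :* (c :* f′) :+ Q :* (d :* f′)))
                 refl g f′ P Q c d ⟩
      g * f′ + (P * (c * f′) + Q * (d * f′))
        ≈⟨ +-congʳ {P * (c * f′) + Q * (d * f′)} (*-congˡ {g} f′≈g′+r′) ⟩
      g * (g′ + (P * c′ + Q * d′)) + (P * (c * f′) + Q * (d * f′))
        ≈⟨ solve 8 (λ g g′ P Q c′ d′ u v →
                      g :* (g′ :+ (P :* c′ :+ Q :* d′)) :+ (P :* u :+ Q :* v)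
                   := g :* g′ :+ (P :* (u :+ g :* c′) :+ Q :* (v :+ g :* d′)))
                 refl g g′ P Q c′ d′ (c * f′) (d * f′) ⟩
      g * g′ + (P * (c * f′ + g * c′) + Q * (d * f′ + g * d′)) ∎)
      where open ≈-Reasoning

    ∼-^ : ∀ {f g} n → f ∼ g → f ^ n ∼ g ^ n
    ∼-^ zero    f∼g = ≈⇒∼ refl
    ∼-^ (suc n) f∼g = ∼-* f∼g (∼-^ n f∼g)

    ∏-∼ : ∀ n {f g} → (∀ i → f i ∼ g i) → ∏< n f ∼ ∏< n g
    ∏-∼ zero    f∼g = ≈⇒∼ refl
    ∏-∼ (suc n) f∼g = ∼-* (f∼g 0) (∏-∼ n (f∼g ∘ suc))

    ∼-isPreorder : IsPreorder _≈_ _∼_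
    ∼-isPreorder = record { isEquivalence = isEquivalence ; reflexive = ≈⇒∼ ; trans = ∼-trans }

    ∼-preorder : Preorder 0ℓ 0ℓ 0ℓ
    ∼-preorder = record { isPreorder = ∼-isPreorder }

    module ∼-Reasoning = PreorderReasoning ∼-preorder

  module Frobenius (p′ : ℕ) (isPrime : Prime (suc p′)) (Q : Series) where

    p : ℕ
    p = suc p′

    open IdealCongruence (p × 1#) Q

    ^p-+-∼ : ∀ x y → (x + y) ^ p ∼ x ^ p + y ^ p
    ^p-+-∼ x y with freshmansDream commutativeSemiring isPrime x y
    ... | e , [x+y]^p≈ = ≈+P*⇒∼ e (trans [x+y]^p≈ (+-congˡ {x ^ p + y ^ p} p×e≈[p×1]*e))
      where
      p×e≈[p×1]*e : p × e ≈ (p × 1#) * e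
      p×e≈[p×1]*e = sym (trans (×-assoc-* p 1# e) (×-congʳ p (*-identityˡ e)))

    -- Derived from additivity, so p = 2 needs no separate treatment.
    -^p-∼ : ∀ x → (- x) ^ p ∼ - (x ^ p)
    -^p-∼ x = begin
      (- x) ^ p                       ≈⟨ solve 2 (λ u v → u := (u :+ v) :- v) refl ((- x) ^ p) (x ^ p) ⟩
      ((- x) ^ p + x ^ p) - x ^ p     ≲⟨ ∼-+ (∼-sym (^p-+-∼ (- x) x)) (≈⇒∼ refl) ⟩
      (- x + x) ^ p - x ^ p           ≈⟨ +-congʳ (^-congˡ p (-‿inverseˡ x)) ⟩
      0# ^ p - x ^ p                  ≈⟨ +-congʳ (zeroˡ (0# ^ p′)) ⟩
      0# - x ^ p                      ≈⟨ +-identityˡ (- (x ^ p)) ⟩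
      - (x ^ p)                       ∎
      where open ∼-Reasoning

    [1-x]^p∼1-x^p : ∀ x → (1# - x) ^ p ∼ 1# - x ^ p
    [1-x]^p∼1-x^p x = begin
      (1# - x) ^ p          ≲⟨ ^p-+-∼ 1# (- x) ⟩
      1# ^ p + (- x) ^ p    ≲⟨ ∼-+ (≈⇒∼ (1#^n≈1# p)) (-^p-∼ x) ⟩
      1# - x ^ p            ∎
      where open ∼-Reasoning

    geometric-^p-∼ : ∀ m → geometric (suc m) ^ p ∼ geometric (suc m ℕ.* p)
    geometric-^p-∼ m = begin
      g ^ p
        ≈⟨ *-identityʳ (g ^ p) ⟨
      g ^ p * 1#
        ≈⟨ *-congˡ {g ^ p} (geometric-inverse (p′ ℕ.+ m ℕ.* p)) ⟨
      g ^ p * ((1# - X ^ (suc m ℕ.* p)) * G)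
        ≈⟨ *-congˡ {g ^ p} (*-congʳ {G} (+-congˡ {1#} (-‿cong (^-assocʳ X (suc m) p)))) ⟨
      g ^ p * ((1# - y ^ p) * G)
        ≲⟨ ∼-* (≈⇒∼ (refl {g ^ p})) (∼-* (∼-sym ([1-x]^p∼1-x^p y)) (≈⇒∼ (refl {G}))) ⟩
      g ^ p * ((1# - y) ^ p * G)
        ≈⟨ *-assoc (g ^ p) ((1# - y) ^ p) G ⟨
      g ^ p * (1# - y) ^ p * G
        ≈⟨ *-congʳ {G} (^-distrib-* g (1# - y) p) ⟨
      (g * (1# - y)) ^ p * G
        ≈⟨ *-congʳ {G} (^-congˡ p (trans (*-comm g (1# - y)) (geometric-inverse m))) ⟩
      1# ^ p * G
        ≈⟨ *-congʳ {G} (1#^n≈1# p) ⟩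
      1# * G
        ≈⟨ *-identityˡ G ⟩
      G ∎
      where
      open ∼-Reasoning
      g y G : Series
      g = geometric (suc m)
      y = X ^ suc m
      G = geometric (suc m ℕ.* p)

  -- Shanks' identity

  ratio : ℕ → Series
  ratio i = (1# - X ^ suc (suc (2 ℕ.* i))) * geometric (suc (2 ℕ.* i))

  ratio-*-[1-X^] : ∀ i → ratio i * (1# - X ^ suc (2 ℕ.* i)) ≈ 1# - X ^ suc (suc (2 ℕ.* i))
  ratio-*-[1-X^] i = begin
    (z * g) * y    ≈⟨ *-assoc z g y ⟩
    z * (g * y)    ≈⟨ *-congˡ {z} (trans (*-comm g y) (geometric-inverse (2 ℕ.* i))) ⟩
    z * 1#         ≈⟨ *-identityʳ z ⟩
    z              ∎
    where
    open ≈-Reasoning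
    z g y : Series
    z = 1# - X ^ suc (suc (2 ℕ.* i))
    g = geometric (suc (2 ℕ.* i))
    y = 1# - X ^ suc (2 ℕ.* i)

  ratios : ℕ → ℕ → Series
  ratios j d = ∏[ i < d ] ratio (j ℕ.+ i)

  ratios-head : ∀ j d → ratios j (suc d) ≈ ratio j * ratios (suc j) d
  ratios-head j d = *-cong (reflexive (≡.cong ratio (ℕₚ.+-identityʳ j)))
                           (∏.cong d (λ i → reflexive (≡.cong ratio (ℕₚ.+-suc j i))))

  -- The partial sum Σ_{k ≤ 2n} X^{k(k+1)/2} of Ramanujan's ψ = f₂²/f₁.
  ψ : ℕ → Series
  ψ zero    = 1#
  ψ (suc m) = ψ m + (X ^ (suc m ℕ.* suc (2 ℕ.* m)) + X ^ (suc m ℕ.* suc (2 ℕ.* suc m)))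

  module Shanks where

    term : ℕ → ℕ → Series
    term n j = X ^ (j ℕ.* suc (2 ℕ.* n)) * ratios j (n ℕ.∸ j)

    -- (term (suc m) j − term m j) · (1 − X^{2m+1}) = upper m j − lower m j, and
    -- upper m j = lower m (suc j), so the sum over j telescopes.
    upper lower : ℕ → ℕ → Series
    upper m j = X ^ (suc j ℕ.* suc (2 ℕ.* m)) * (1# - X ^ suc (2 ℕ.* j)) * ratios j (m ℕ.∸ j)
    lower m j = X ^ (j ℕ.* suc (2 ℕ.* m)) * (1# - X ^ (2 ℕ.* j)) * ratios j (m ℕ.∸ j)

    term-step : ∀ m j → j ℕ.≤ m →
      (term (suc m) j - term m j) * (1# - X ^ suc (2 ℕ.* m)) ≈ upper m j - lower m j
    term-step m j j≤m = begin
      (term (suc m) j - term m j) * (1# - y)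
        ≈⟨ *-congʳ {1# - y} (+-congʳ { - term m j} (*-cong X^[j*[2m+3]]≈c*A ratios-snoc)) ⟩
      ((c * A) * (R * ratio m) - c * R) * (1# - y)
        ≈⟨ solve 5 (λ c A R r y →
             ((c :* A) :* (R :* r) :- c :* R) :* (con 1ℤ :- y)
          := c :* A :* R :* (r :* (con 1ℤ :- y)) :- c :* R :* (con 1ℤ :- y))
            refl c A R (ratio m) y ⟩
      c * A * R * (ratio m * (1# - y)) - c * R * (1# - y)
        ≈⟨ +-congʳ { - (c * R * (1# - y))} (*-congˡ {c * A * R} (ratio-*-[1-X^] m)) ⟩
      c * A * R * (1# - X * y) - c * R * (1# - y)
        ≈⟨ solve 5 (λ c A R x y →
             c :* A :* R :* (con 1ℤ :- x :* y) :- c :* R :* (con 1ℤ :- y)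
          := y :* c :* (con 1ℤ :- x :* A) :* R :- c :* (con 1ℤ :- A) :* R)
            refl c A R X y ⟩
      y * c * (1# - X * A) * R - c * (1# - A) * R
        ≈⟨ +-congʳ { - lower m j} (*-congʳ {R} (*-congʳ {1# - X * A} X^[[j+1][2m+1]]≈y*c)) ⟨
      upper m j - lower m j ∎
      where
      open ≈-Reasoning
      c A R y : Series
      c = X ^ (j ℕ.* suc (2 ℕ.* m))
      A = X ^ (2 ℕ.* j)
      R = ratios j (m ℕ.∸ j)
      y = X ^ suc (2 ℕ.* m)
      X^[[j+1][2m+1]]≈y*c : X ^ (suc j ℕ.* suc (2 ℕ.* m)) ≈ y * c
      X^[[j+1][2m+1]]≈y*c = ^-homo-* X (suc (2 ℕ.* m)) (j ℕ.* suc (2 ℕ.* m))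
      X^[j*[2m+3]]≈c*A : X ^ (j ℕ.* suc (2 ℕ.* suc m)) ≈ c * A
      X^[j*[2m+3]]≈c*A = trans (^-congʳ X (exponent j m)) (^-homo-* X (j ℕ.* suc (2 ℕ.* m)) (2 ℕ.* j))
        where
        exponent : ∀ j m → j ℕ.* suc (2 ℕ.* suc m) ≡ j ℕ.* suc (2 ℕ.* m) ℕ.+ 2 ℕ.* j
        exponent = ℕ-Solver.solve-∀
      ratios-snoc : ratios j (suc m ℕ.∸ j) ≈ R * ratio m
      ratios-snoc = begin
        ratios j (suc m ℕ.∸ j)           ≡⟨ ≡.cong (ratios j) (ℕₚ.+-∸-assoc 1 j≤m) ⟩
        ratios j (suc (m ℕ.∸ j))         ≈⟨ ∏.snoc (m ℕ.∸ j) (λ i → ratio (j ℕ.+ i)) ⟩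
        R * ratio (j ℕ.+ (m ℕ.∸ j))      ≡⟨ ≡.cong (λ i → R * ratio i) (ℕₚ.m+[n∸m]≡n j≤m) ⟩
        R * ratio m                      ∎

    upper≈lower∘suc : ∀ m j → j ℕ.< m → upper m j ≈ lower m (suc j)
    upper≈lower∘suc m j j<m = begin
      b * u * ratios j (m ℕ.∸ j)
        ≡⟨ ≡.cong (λ d → b * u * ratios j d) (ℕₚ.+-∸-assoc 1 j<m) ⟩
      b * u * ratios j (suc (m ℕ.∸ suc j))
        ≈⟨ *-congˡ {b * u} (ratios-head j (m ℕ.∸ suc j)) ⟩
      b * u * (ratio j * R)
        ≈⟨ solve 4 (λ b u r R → b :* u :* (r :* R) := b :* (r :* u) :* R) refl b u (ratio j) R ⟩
      b * (ratio j * u) * R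
        ≈⟨ *-congʳ {R} (*-congˡ {b} (ratio-*-[1-X^] j)) ⟩
      b * (1# - X ^ suc (suc (2 ℕ.* j))) * R
        ≡⟨ ≡.cong (λ e → b * (1# - X ^ e) * R) (ℕₚ.*-suc 2 j) ⟨
      lower m (suc j) ∎
      where
      open ≈-Reasoning
      b u R : Series
      b = X ^ (suc j ℕ.* suc (2 ℕ.* m))
      u = 1# - X ^ suc (2 ℕ.* j)
      R = ratios (suc j) (m ℕ.∸ suc j)

    lower-0 : ∀ m → lower m 0 ≈ 0#
    lower-0 m = trans (*-congʳ {ratios 0 m} (trans (*-identityˡ (1# - 1#)) (-‿inverseʳ 1#))) (zeroˡ (ratios 0 m))

    upper-diagonal : ∀ m → upper m m ≈ X ^ (suc m ℕ.* suc (2 ℕ.* m)) * (1# - X ^ suc (2 ℕ.* m))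
    upper-diagonal m = begin
      c * ratios m (m ℕ.∸ m)  ≡⟨ ≡.cong (λ d → c * ratios m d) (ℕₚ.n∸n≡0 m) ⟩
      c * 1#                  ≈⟨ *-identityʳ c ⟩
      c                       ∎
      where
      open ≈-Reasoning
      c : Series
      c = X ^ (suc m ℕ.* suc (2 ℕ.* m)) * (1# - X ^ suc (2 ℕ.* m))

    ∑-term-differences : ∀ m → ∑[ j < suc m ] (term (suc m) j - term m j) ≈ X ^ (suc m ℕ.* suc (2 ℕ.* m))
    ∑-term-differences m = [1-X^]-cancelʳ (2 ℕ.* m) (begin
      (∑[ j < suc m ] (term (suc m) j - term m j)) * (1# - y)
        ≈⟨ ∑-*-distribʳ (suc m) (λ j → term (suc m) j - term m j) (1# - y) ⟩
      ∑[ j < suc m ] ((term (suc m) j - term m j) * (1# - y))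
        ≈⟨ ∑.cong< (suc m) (λ j j<1+m → term-step m j (ℕₚ.≤-pred j<1+m)) ⟩
      ∑[ j < suc m ] (upper m j - lower m j)
        ≈⟨ ∑-telescope m (upper m) (lower m) (upper≈lower∘suc m) ⟩
      upper m m - lower m 0
        ≈⟨ +-cong (upper-diagonal m) (-‿cong (lower-0 m)) ⟩
      X ^ (suc m ℕ.* suc (2 ℕ.* m)) * (1# - y) - 0#
        ≈⟨ +-identityʳ _ ⟩
      X ^ (suc m ℕ.* suc (2 ℕ.* m)) * (1# - y) ∎)
      where
      open ≈-Reasoning
      y : Series
      y = X ^ suc (2 ℕ.* m)

    sum : ℕ → Series
    sum n = ∑[ j < suc n ] term n j

    identity : ∀ n → sum n ≈ ψ n
    identity zero    = trans (+-identityʳ (1# * 1#)) (*-identityˡ 1#)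
    identity (suc m) = begin
      ∑[ j < suc (suc m) ] term (suc m) j
        ≈⟨ ∑.snoc (suc m) (term (suc m)) ⟩
      (∑[ j < suc m ] term (suc m) j) + term (suc m) (suc m)
        ≈⟨ +-cong (∑.cong (suc m) (λ j → x≈y+[x-y] (term (suc m) j) (term m j))) last-term ⟩
      (∑[ j < suc m ] (term m j + difference j)) + X ^ e₂
        ≈⟨ +-congʳ {X ^ e₂} (∑.distrib (suc m) (term m) difference) ⟩
      (sum m + (∑[ j < suc m ] difference j)) + X ^ e₂
        ≈⟨ +-congʳ {X ^ e₂} (+-cong (identity m) (∑-term-differences m)) ⟩
      (ψ m + X ^ e₁) + X ^ e₂
        ≈⟨ +-assoc (ψ m) (X ^ e₁) (X ^ e₂) ⟩
      ψ (suc m) ∎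
      where
      open ≈-Reasoning
      e₁ e₂ : ℕ
      e₁ = suc m ℕ.* suc (2 ℕ.* m)
      e₂ = suc m ℕ.* suc (2 ℕ.* suc m)
      difference : ℕ → Series
      difference j = term (suc m) j - term m j
      x≈y+[x-y] : ∀ x y → x ≈ y + (x - y)
      x≈y+[x-y] = solve 2 (λ x y → x := y :+ (x :- y)) refl
      last-term : term (suc m) (suc m) ≈ X ^ e₂
      last-term = trans (reflexive (≡.cong (λ d → X ^ e₂ * ratios (suc m) d) (ℕₚ.n∸n≡0 m))) (*-identityʳ (X ^ e₂))

  ratios-0≈ψ+X^[1+n]* : ∀ n → ∃ λ R → ratios 0 n ≈ ψ n + X ^ suc n * R
  ratios-0≈ψ+X^[1+n]* n = - R , (begin
    ratios 0 n
      ≈⟨ solve 3 (λ u v w → u := (con 1ℤ :* u :+ v :* w) :- v :* w) refl (ratios 0 n) (X ^ suc n) R ⟩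
    (1# * ratios 0 n + X ^ suc n * R) - X ^ suc n * R
      ≈⟨ +-congʳ { - (X ^ suc n * R)} (+-congˡ {1# * ratios 0 n} ∑-term∘suc) ⟨
    Shanks.sum n - X ^ suc n * R
      ≈⟨ +-congʳ { - (X ^ suc n * R)} (Shanks.identity n) ⟩
    ψ n - X ^ suc n * R
      ≈⟨ solve 3 (λ u v w → u :- v :* w := u :+ v :* (:- w)) refl (ψ n) (X ^ suc n) R ⟩
    ψ n + X ^ suc n * - R ∎)
    where
    open ≈-Reasoning
    T : ℕ → Series
    T j = X ^ (n ℕ.+ j ℕ.* suc (2 ℕ.* n)) * ratios (suc j) (n ℕ.∸ suc j)
    R : Series
    R = ∑[ j < n ] T j
    exponent : ∀ n j → suc j ℕ.* suc (2 ℕ.* n) ≡ suc n ℕ.+ (n ℕ.+ j ℕ.* suc (2 ℕ.* n))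
    exponent = ℕ-Solver.solve-∀
    term∘suc : ∀ j → Shanks.term n (suc j) ≈ X ^ suc n * T j
    term∘suc j = trans (*-congʳ {ratios (suc j) (n ℕ.∸ suc j)}
                          (trans (^-congʳ X (exponent n j)) (^-homo-* X (suc n) (n ℕ.+ j ℕ.* suc (2 ℕ.* n)))))
                       (*-assoc (X ^ suc n) _ _)
    ∑-term∘suc : (∑[ j < n ] Shanks.term n (suc j)) ≈ X ^ suc n * R
    ∑-term∘suc = trans (∑.cong n term∘suc) (sym (∑-*-distribˡ n (X ^ suc n) T))

  Supported : (ℕ → Set) → Series → Set
  Supported S f = ∀ n → ¬ S n → f n ≡ 0ℤ

  supported-mono : ∀ {S T f} → (∀ {n} → S n → T n) → Supported S f → Supported T f
  supported-mono S⇒T f-supp n ¬Tn = f-supp n (¬Tn ∘ S⇒T)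

  *-coeff-≡0 : ∀ f g n → (∀ i j → i ℕ.+ j ≡ n → f i ℤ.* g j ≡ 0ℤ) → (f * g) n ≡ 0ℤ
  *-coeff-≡0 f g zero    fg≡0 = fg≡0 0 0 ≡.refl
  *-coeff-≡0 f g (suc n) fg≡0 =
    ≡.cong₂ ℤ._+_ (fg≡0 0 (suc n) ≡.refl)
                  (*-coeff-≡0 (tail f) g n (λ i j i+j≡n → fg≡0 (suc i) j (≡.cong suc i+j≡n)))

  *-coeff-disjoint : ∀ {S T f g} n → Decidable S → Supported S f → Supported T g →
                     (∀ i j → i ℕ.+ j ≡ n → S i → ¬ T j) → (f * g) n ≡ 0ℤ
  *-coeff-disjoint {S} {T} {f} {g} n S? f-supp g-supp disjoint = *-coeff-≡0 f g n fg≡0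
    where
    fg≡0 : ∀ i j → i ℕ.+ j ≡ n → f i ℤ.* g j ≡ 0ℤ
    fg≡0 i j i+j≡n with S? i
    ... | yes Si = ≡.trans (≡.cong (f i ℤ.*_) (g-supp j (disjoint i j i+j≡n Si))) (ℤₚ.*-zeroʳ (f i))
    ... | no ¬Si = ≡.trans (≡.cong (ℤ._* g j) (f-supp i ¬Si)) (ℤₚ.*-zeroˡ (g j))

  1#-supported : ∀ {S} → S 0 → Supported S 1#
  1#-supported S0 zero    ¬S0 = contradiction S0 ¬S0
  1#-supported S0 (suc n) _   = ≡.refl

  +-supported : ∀ {S f g} → Supported S f → Supported S g → Supported S (f + g)
  +-supported f-supp g-supp n ¬Sn = ≡.cong₂ ℤ._+_ (f-supp n ¬Sn) (g-supp n ¬Sn)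

  X^-supported : ∀ {S} k → S k → Supported S (X ^ k)
  X^-supported {S} k Sk n ¬Sn = X^-coeff-≢ k (λ n≡k → ¬Sn (≡.subst S (≡.sym n≡k) Sk))

  module SupportClosure {S : ℕ → Set} (S? : Decidable S) (S-+ : ∀ {i j} → S i → S j → S (i ℕ.+ j)) where

    *-supported : ∀ {f g} → Supported S f → Supported S g → Supported S (f * g)
    *-supported f-supp g-supp n ¬Sn =
      *-coeff-disjoint n S? f-supp g-supp (λ i j i+j≡n Si Sj → ¬Sn (≡.subst S i+j≡n (S-+ Si Sj)))

    ^-supported : ∀ {f} → S 0 → Supported S f → ∀ e → Supported S (f ^ e)
    ^-supported S0 f-supp zero    = 1#-supported S0
    ^-supported S0 f-supp (suc e) = *-supported f-supp (^-supported S0 f-supp e)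

    ∏-supported : ∀ {f} → S 0 → (∀ i → Supported S (f i)) → ∀ n → Supported S (∏< n f)
    ∏-supported S0 f-supp zero    = 1#-supported S0
    ∏-supported S0 f-supp (suc n) = *-supported (f-supp 0) (∏-supported S0 (f-supp ∘ suc) n)

  geometric-coeff-off : ∀ k r t → 0 ℕ.< r → r ℕ.< suc k → geometric (suc k) (r ℕ.+ t ℕ.* suc k) ≡ 0ℤ
  geometric-coeff-off k r@(suc _) zero    _ r<1+k =
    ≡.cong ℤ.+_ (≡.trans (≡.cong (multisets (suc k ∷ [])) (ℕₚ.+-identityʳ r))
                         (multisets-∷-< (suc k) [] r r<1+k))
  geometric-coeff-off k r (suc t) 0<r r<1+k = begin
    geometric (suc k) (r ℕ.+ (suc k ℕ.+ t ℕ.* suc k))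
      ≡⟨ ≡.cong (geometric (suc k)) (swap r (suc k) (t ℕ.* suc k)) ⟩
    geometric (suc k) (suc k ℕ.+ (r ℕ.+ t ℕ.* suc k))
      ≡⟨ ≡.cong ℤ.+_ (multisets-∷-+ k [] (r ℕ.+ t ℕ.* suc k)) ⟩
    geometric (suc k) (r ℕ.+ t ℕ.* suc k)
      ≡⟨ geometric-coeff-off k r t 0<r r<1+k ⟩
    0ℤ ∎
    where
    open ≡-Reasoning
    swap : ∀ a b c → a ℕ.+ (b ℕ.+ c) ≡ b ℕ.+ (a ℕ.+ c)
    swap = ℕ-Solver.solve-∀

  geometric-supported : ∀ k → Supported (suc k ∣_) (geometric (suc k))
  geometric-supported k n 1+k∤n with n ℕ.% suc k | m≡m%n+[m/n]*n n (suc k) | m%n<n n (suc k)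
  ... | zero      | n≡0+q*[1+k] | _     = contradiction (divides (n ℕ./ suc k) n≡0+q*[1+k]) 1+k∤n
  ... | r@(suc _) | n≡r+q*[1+k] | r<1+k =
    ≡.trans (≡.cong (geometric (suc k)) n≡r+q*[1+k]) (geometric-coeff-off k r (n ℕ./ suc k) (s≤s z≤n) r<1+k)

  ψ-supported : ∀ n → Supported Triangular (ψ n)
  ψ-supported zero    = 1#-supported (1 , ≡.refl)
  ψ-supported (suc m) = +-supported (ψ-supported m)
    (+-supported (X^-supported (suc m ℕ.* suc (2 ℕ.* m)) (4 ℕ.* m ℕ.+ 3 , odd m))
                 (X^-supported (suc m ℕ.* suc (2 ℕ.* suc m)) (4 ℕ.* m ℕ.+ 5 , even m)))
    where
    odd : ∀ m → 8 ℕ.* (suc m ℕ.* suc (2 ℕ.* m)) ℕ.+ 1 ≡ (4 ℕ.* m ℕ.+ 3) ℕ.* (4 ℕ.* m ℕ.+ 3)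
    odd = ℕ-Solver.solve-∀
    even : ∀ m → 8 ℕ.* (suc m ℕ.* suc (2 ℕ.* suc m)) ℕ.+ 1 ≡ (4 ℕ.* m ℕ.+ 5) ℕ.* (4 ℕ.* m ℕ.+ 5)
    even = ℕ-Solver.solve-∀

  module ModuloPrime (p′ : ℕ) (isPrime : Prime (suc p′)) (N : ℕ) where

    open Frobenius p′ isPrime (X ^ suc N) using (p; geometric-^p-∼)
    open IdealCongruence (p × 1#) (X ^ suc N)

    geometric-∼-1 : ∀ i → geometric (suc N ℕ.+ i) ∼ 1#
    geometric-∼-1 i = ≈+Q*⇒∼ (X ^ i * g) (begin
      g                                          ≈⟨ multisetSeries-∷ (N ℕ.+ i) [] ⟩
      multisetSeries [] + X ^ (suc N ℕ.+ i) * g  ≈⟨ +-cong multisetSeries-[] (*-congʳ {g} (^-homo-* X (suc N) i)) ⟩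
      1# + X ^ suc N * X ^ i * g                 ≈⟨ +-congˡ {1#} (*-assoc (X ^ suc N) (X ^ i) g) ⟩
      1# + X ^ suc N * (X ^ i * g)               ∎)
      where
      open ≈-Reasoning
      g : Series
      g = geometric (suc N ℕ.+ i)

    ∏-extend : ∀ f → (∀ i → f (N ℕ.+ i) ∼ 1#) → ∏< N f ∼ ∏< (2 ℕ.* N) f
    ∏-extend f f∼1 = ∼-sym (begin
      ∏< (2 ℕ.* N) f                     ≡⟨ ≡.cong (λ n → ∏< (N ℕ.+ n) f) (ℕₚ.+-identityʳ N) ⟩
      ∏< (N ℕ.+ N) f                     ≈⟨ ∏.split N N f ⟩
      ∏< N f * (∏[ i < N ] f (N ℕ.+ i))  ≲⟨ ∼-* (≈⇒∼ (refl {∏< N f})) (∏-∼ N f∼1) ⟩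
      ∏< N f * (∏[ i < N ] 1#)           ≈⟨ *-congˡ {∏< N f} (∏.neutral N) ⟩
      ∏< N f * 1#                        ≈⟨ *-identityʳ (∏< N f) ⟩
      ∏< N f                             ∎)
      where open ∼-Reasoning

    ratios-0∼ψ : ratios 0 N ∼ ψ N
    ratios-0∼ψ = ≈+Q*⇒∼ (proj₁ (ratios-0≈ψ+X^[1+n]* N)) (proj₂ (ratios-0≈ψ+X^[1+n]* N))

    ∼-coeff : ∀ {f g} (f∼g : f ∼ g) → f N ≡ g N ℤ.+ ℤ.+ p ℤ.* _∼_.cofactor₁ f∼g N
    ∼-coeff {f} {g} (differ-by c d f≈g+p*c+Q*d) = begin
      f N
        ≡⟨ f≈g+p*c+Q*d N ⟩
      g N ℤ.+ (((p × 1#) * c) N ℤ.+ (X ^ suc N * d) N)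
        ≡⟨ ≡.cong₂ (λ x y → g N ℤ.+ (x ℤ.+ y)) p×1*c-coeff (X^*-coeff-< (suc N) d (ℕₚ.n<1+n N)) ⟩
      g N ℤ.+ (ℤ.+ p ℤ.* c N ℤ.+ 0ℤ)
        ≡⟨ ≡.cong (ℤ._+_ (g N)) (ℤₚ.+-identityʳ _) ⟩
      g N ℤ.+ ℤ.+ p ℤ.* c N ∎
      where
      open ≡-Reasoning
      p×1*c-coeff : ((p × 1#) * c) N ≡ ℤ.+ p ℤ.* c N
      p×1*c-coeff = begin
        ((p × 1#) * c) N      ≡⟨ ×-assoc-* p 1# c N ⟩
        (p × (1# * c)) N      ≡⟨ ×-coeff p (1# * c) N ⟩
        ℤ.+ p ℤ.* (1# * c) N  ≡⟨ ≡.cong (ℤ.+ p ℤ.*_) (*-identityˡ c N) ⟩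
        ℤ.+ p ℤ.* c N         ∎

    module _ (u k : ℕ) where

      r s : ℕ
      r = p ℕ.* u ℕ.+ p′
      s = p ℕ.* k ℕ.+ (p ℕ.+ 1)

      x^s≈[x^p]^[1+k]*x : ∀ x → x ^ s ≈ (x ^ p) ^ suc k * x
      x^s≈[x^p]^[1+k]*x x = begin
        x ^ s                  ≡⟨ ≡.cong (x ^_) (s≡p*[1+k]+1 p k) ⟩
        x ^ (p ℕ.* suc k ℕ.+ 1)  ≈⟨ x^[n+1]≈x^n*x x (p ℕ.* suc k) ⟩
        x ^ (p ℕ.* suc k) * x    ≈⟨ *-congʳ {x} (^-assocʳ x p (suc k)) ⟨
        (x ^ p) ^ suc k * x      ∎
        where
        open ≈-Reasoning
        s≡p*[1+k]+1 : ∀ p k → p ℕ.* k ℕ.+ (p ℕ.+ 1) ≡ p ℕ.* suc k ℕ.+ 1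
        s≡p*[1+k]+1 = ℕ-Solver.solve-∀

      geometric^r : ∀ m → geometric (suc m) ^ r ≈ (geometric (suc m) ^ p) ^ suc u * (1# - X ^ suc m)
      geometric^r m = begin
        g ^ r                        ≈⟨ *-identityʳ (g ^ r) ⟨
        g ^ r * 1#                   ≈⟨ *-congˡ {g ^ r} (geometric-inverse m) ⟨
        g ^ r * ((1# - y) * g)       ≈⟨ x∙yz≈xz∙y (g ^ r) (1# - y) g ⟩
        g ^ r * g * (1# - y)         ≈⟨ *-congʳ {1# - y} (x^[n+1]≈x^n*x g r) ⟨
        g ^ (r ℕ.+ 1) * (1# - y)     ≡⟨ ≡.cong (λ e → g ^ e * (1# - y)) (r+1≡p*[1+u] p′ u) ⟩
        g ^ (p ℕ.* suc u) * (1# - y) ≈⟨ *-congʳ {1# - y} (^-assocʳ g p (suc u)) ⟨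
        (g ^ p) ^ suc u * (1# - y)   ∎
        where
        open ≈-Reasoning
        g y : Series
        g = geometric (suc m)
        y = X ^ suc m
        r+1≡p*[1+u] : ∀ p′ u → suc p′ ℕ.* u ℕ.+ p′ ℕ.+ 1 ≡ suc p′ ℕ.* suc u
        r+1≡p*[1+u] = ℕ-Solver.solve-∀

      colouredFactor : ℕ → Series
      colouredFactor i = geometric (suc i) ^ colours r s (suc i)

      frobeniusFactor : ℕ → Series
      frobeniusFactor j = (geometric (suc (2 ℕ.* j)) ^ p) ^ suc k * (geometric (suc (suc (2 ℕ.* j))) ^ p) ^ suc u

      pair-factor : ∀ j →
        colouredFactor (2 ℕ.* j) * colouredFactor (suc (2 ℕ.* j)) ≈ frobeniusFactor j * ratio j
      pair-factor j = begin
        colouredFactor (2 ℕ.* j) * colouredFactor (suc (2 ℕ.* j))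
          ≡⟨ ≡.cong₂ (λ e e′ → g₁ ^ e * g₂ ^ e′) (colours-odd r s j) (colours-even r s j) ⟩
        g₁ ^ s * g₂ ^ r
          ≈⟨ *-cong (x^s≈[x^p]^[1+k]*x g₁) (geometric^r (suc (2 ℕ.* j))) ⟩
        (g₁ ^ p) ^ suc k * g₁ * ((g₂ ^ p) ^ suc u * (1# - y₂))
          ≈⟨ solve 4 (λ a g₁ b y → a :* g₁ :* (b :* (con 1ℤ :- y)) := a :* b :* ((con 1ℤ :- y) :* g₁))
                   refl ((g₁ ^ p) ^ suc k) g₁ ((g₂ ^ p) ^ suc u) y₂ ⟩
        frobeniusFactor j * ratio j ∎
        where
        open ≈-Reasoning
        g₁ g₂ y₂ : Series
        g₁ = geometric (suc (2 ℕ.* j))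
        g₂ = geometric (suc (suc (2 ℕ.* j)))
        y₂ = X ^ suc (suc (2 ℕ.* j))

      colouredFactor-∼-1 : ∀ i → colouredFactor (N ℕ.+ i) ∼ 1#
      colouredFactor-∼-1 i = ∼-trans (∼-^ c (geometric-∼-1 i)) (≈⇒∼ (1#^n≈1# c))
        where
        c : ℕ
        c = colours r s (suc N ℕ.+ i)

      frobeniusImage : ℕ → Series
      frobeniusImage j = geometric (suc (2 ℕ.* j) ℕ.* p) ^ suc k * geometric (suc (suc (2 ℕ.* j)) ℕ.* p) ^ suc u

      frobeniusFactor-∼ : ∀ j → frobeniusFactor j ∼ frobeniusImage j
      frobeniusFactor-∼ j =
        ∼-* (∼-^ (suc k) (geometric-^p-∼ (2 ℕ.* j))) (∼-^ (suc u) (geometric-^p-∼ (suc (2 ℕ.* j))))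

      generating-∼ : ∏< N colouredFactor ∼ ∏< N frobeniusImage * ψ N
      generating-∼ = begin
        ∏< N colouredFactor
          ≲⟨ ∏-extend colouredFactor colouredFactor-∼-1 ⟩
        ∏< (2 ℕ.* N) colouredFactor
          ≈⟨ ∏.pairs N colouredFactor ⟩
        ∏[ j < N ] (colouredFactor (2 ℕ.* j) * colouredFactor (suc (2 ℕ.* j)))
          ≈⟨ ∏.cong N pair-factor ⟩
        ∏[ j < N ] (frobeniusFactor j * ratio j)
          ≈⟨ ∏.distrib N frobeniusFactor ratio ⟩
        ∏< N frobeniusFactor * ratios 0 N
          ≲⟨ ∼-* (∏-∼ N frobeniusFactor-∼) ratios-0∼ψ ⟩
        ∏< N frobeniusImage * ψ N ∎
        where open ∼-Reasoning

      frobeniusImage-supported : Supported (p ∣_) (∏< N frobeniusImage)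
      frobeniusImage-supported = ∏-supported (p ∣0) (λ j →
        *-supported (^-supported (p ∣0) (geometric-[m*p]-supported (2 ℕ.* j)) (suc k))
                    (^-supported (p ∣0) (geometric-[m*p]-supported (suc (2 ℕ.* j))) (suc u))) N
        where
        open SupportClosure (p ∣?_) ∣m∣n⇒∣m+n
        geometric-[m*p]-supported : ∀ m → Supported (p ∣_) (geometric (suc m ℕ.* p))
        geometric-[m*p]-supported m = supported-mono (∣-trans (n∣m*n (suc m))) (geometric-supported (p′ ℕ.+ m ℕ.* p))

    p∣a : ∀ u k → (∀ i j → i ℕ.+ j ≡ N → p ∣ i → ¬ Triangular j) →
          p ∣ a (p ℕ.* u ℕ.+ p′) (p ℕ.* k ℕ.+ (p ℕ.+ 1)) N
    p∣a u k disjoint = +m≡+n*c⇒n∣m c (begin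
      ℤ.+ a (r u k) (s u k) N                           ≡⟨ a≡∏-coeff (r u k) (s u k) N ⟩
      ∏< N (colouredFactor u k) N                       ≡⟨ ∼-coeff (generating-∼ u k) ⟩
      (∏< N (frobeniusImage u k) * ψ N) N ℤ.+ ℤ.+ p ℤ.* c  ≡⟨ ≡.cong (ℤ._+ ℤ.+ p ℤ.* c) vanishes ⟩
      0ℤ ℤ.+ ℤ.+ p ℤ.* c                                ≡⟨ ℤₚ.+-identityˡ _ ⟩
      ℤ.+ p ℤ.* c                                       ∎)
      where
      open ≡-Reasoning
      c : ℤ
      c = _∼_.cofactor₁ (generating-∼ u k) N
      vanishes : (∏< N (frobeniusImage u k) * ψ N) N ≡ 0ℤ
      vanishes = *-coeff-disjoint N (p ∣?_) (frobeniusImage-supported u k) (ψ-supported N) disjoint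

open GeneratingFunctions using (module ModuloPrime)
open import Data.Nat using (_+_; _*_; _∸_; _≤_)

theorem1p17 : (p r : ℕ) → Prime p → 3 ≤ p → 1 ≤ r → r ≤ p ∸ 1 →
    (q : QNR p (8 * r + 1)) →
    (n k j : ℕ) → j ≤ k →
    p ∣ a (p * (k ∸ j) + (p ∸ 1)) (p * k + (p + 1)) (p * n + r)
theorem1p17 zero     r ()
theorem1p17 (suc p′) r isPrime _ _ _ qnr n k j _ =
  ModuloPrime.p∣a p′ isPrime (suc p′ * n + r) (k ∸ j) k (qnr⇒disjoint n qnr)
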